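{- Let $r$ and $s$ be positive integers with $r \geq s \geq 2$. If $r > 3s - 3$, then $f(s,r,3) = 3s + 3r - 4$.
   Context: For integers $a\le b$, $[a,b]=\{n\in\mathbb{N} : a\le n\le b\}$. For a finite set $X\subseteq\mathbb{N}$, $\mathrm{diam}(X)=\max(X)-\min(X)$. $f(s,r,3)$ denotes the smallest positive integer $n$ such that for every coloring $\Delta:[1,n]\to\{1,2,3\}$ there exist subsets $S_1,S_2\subseteq[1,n]$ with: (a) $S_1$ and $S_2$ each monochromatic (not necessarily of the same color); (b) $|S_1|=s$, $|S_2|=r$; (c) $\max(S_1)<\min(S_2)$; (d) $\mathrm{diam}(S_1)\le\mathrm{diam}(S_2)$. -}

module Defs where

open import Data.Nat using (ℕ; zero; suc; _≤_; _<_; _∸_; _⊔_; _⊓_)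
open import Data.Fin using (Fin)
open import Data.List using (List; []; _∷_; foldr; length)
open import Data.List.Relation.Unary.All using (All)
open import Data.List.Relation.Unary.Unique.Propositional using (Unique)
open import Data.Product using (Σ; _×_; ∃)
open import Relation.Binary.PropositionalEquality using (_≡_)
open import Relation.Nullary using (¬_)

-- A finite set of naturals is represented by a duplicate-free list.
-- Maximum and minimum of a finite set (only used for nonempty sets).
maxL : List ℕ → ℕ
maxL []       = 0
maxL (x ∷ xs) = foldr _⊔_ x xs

minL : List ℕ → ℕ
minL []       = 0
minL (x ∷ xs) = foldr _⊓_ x xs

diam : List ℕ → ℕ
diam X = maxL X ∸ minL X

InRange : ℕ → List ℕ → Set
InRange n X = All (λ x → 1 ≤ x × x ≤ n) X

Mono : (ℕ → Fin 3) → List ℕ → Set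
Mono Δ X = Σ (Fin 3) λ k → All (λ x → Δ x ≡ k) X

GoodPair : ℕ → ℕ → ℕ → (ℕ → Fin 3) → List ℕ → List ℕ → Set
GoodPair s r n Δ S₁ S₂ =
  Unique S₁ × Unique S₂ ×
  InRange n S₁ × InRange n S₂ ×
  Mono Δ S₁ × Mono Δ S₂ ×
  length S₁ ≡ s × length S₂ ≡ r ×
  maxL S₁ < minL S₂ ×
  diam S₁ ≤ diam S₂

-- every 3-colouring of [1,n] admits such a pair
-- (a colouring of [1,n] is given as a function on ℕ; only its values on [1,n] matter)
Property : ℕ → ℕ → ℕ → Set
Property s r n = (Δ : ℕ → Fin 3) → ∃ λ S₁ → ∃ λ S₂ → GoodPair s r n Δ S₁ S₂

IsF3 : ℕ → ℕ → ℕ → Set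
IsF3 s r N = 1 ≤ N × Property s r N × ((m : ℕ) → 1 ≤ m → m < N → ¬ Property s r m)

-- Upper bound: in [1, 3s+3r−4] the first 3s−2 points contain s of one colour,
-- spanning a diameter ≤ 3s−3, and the remaining 3r−2 points contain r of one
-- colour, whose diameter is ≥ r−1 ≥ 3s−3.  Lower bound: colour [1, 3s−3] by
-- three consecutive monochromatic stripes of width s−1 and [3s−1, 3s+3r−5] by
-- three stripes of width r−1.  A set of s points of one colour then has to
-- reach 3s−2, which forces S₂ into the second range, where no colour has r points.
-- Below, a = s − 1 and b = r − 1.
module Submission where

open import Defs
open import Data.Nat using (ℕ; zero; suc; _+_; _*_; _∸_; _⊔_; _⊓_; _≤_; _<_; z≤n; s≤s; s≤s⁻¹; z<s; _≟_; _<?_)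
open import Data.Nat.Properties
open import Data.Nat.Tactic.RingSolver using (solve-∀)
open import Data.Fin using (Fin)
import Data.Fin as Fin
open import Data.Fin.Patterns using (0F; 1F; 2F)
open import Data.List using (List; []; _∷_; foldr; length; filter; take; applyUpTo)
open import Data.List.Properties using (length-take; length-applyUpTo; filter-all; filter-accept; filter-reject)
open import Data.List.Relation.Unary.All as All using (All; []; _∷_)
import Data.List.Relation.Unary.All.Properties as All
open import Data.List.Relation.Unary.Unique.Propositional using (Unique)
import Data.List.Relation.Unary.Unique.Propositional.Properties as Unique
open import Data.List.Relation.Unary.AllPairs using ([]; _∷_)
open import Data.Product using (∃; _×_; _,_; proj₁; proj₂)
open import Function using (_∘_)
open import Relation.Nullary using (¬_; yes; no; ¬?; contradiction)
open import Relation.Binary.PropositionalEquality using (_≡_; ≢-sym; refl; sym; trans; cong; subst)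

infix 4 _∈[_,_⟩

_∈[_,_⟩ : ℕ → ℕ → ℕ → Set
x ∈[ lo , hi ⟩ = lo ≤ x × x < hi

interval : ℕ → ℕ → List ℕ
interval lo d = applyUpTo (lo +_) d

interval-length : ∀ lo d → length (interval lo d) ≡ d
interval-length lo d = length-applyUpTo (lo +_) d

interval-unique : ∀ lo d → Unique (interval lo d)
interval-unique lo d = Unique.applyUpTo⁺₁ (lo +_) d (λ i<j _ → <⇒≢ (+-monoʳ-< lo i<j))

interval-bounds : ∀ lo d → All (_∈[ lo , lo + d ⟩) (interval lo d)
interval-bounds lo d = All.applyUpTo⁺₁ (lo +_) d (λ {i} i<d → m≤m+n lo i , +-monoʳ-< lo i<d)

maxL-ub : ∀ xs → All (_≤ maxL xs) xs
maxL-ub []       = []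
maxL-ub (x ∷ xs) = proj₁ (fold-ub x xs) ∷ proj₂ (fold-ub x xs)
  where
  fold-ub : ∀ x xs → x ≤ foldr _⊔_ x xs × All (_≤ foldr _⊔_ x xs) xs
  fold-ub x []       = ≤-refl , []
  fold-ub x (y ∷ ys) =
    let x≤m , ys≤m = fold-ub x ys
    in  ≤-trans x≤m (m≤n⊔m y _) , m≤m⊔n y _ ∷ All.map (λ z≤m → ≤-trans z≤m (m≤n⊔m y _)) ys≤m

maxL-lub : ∀ {b} xs → All (_≤ b) xs → maxL xs ≤ b
maxL-lub []       _            = z≤n
maxL-lub (x ∷ xs) (x≤b ∷ xs≤b) = fold-lub xs xs≤b
  where
  fold-lub : ∀ ys → All (_≤ _) ys → foldr _⊔_ x ys ≤ _
  fold-lub []       []           = x≤b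
  fold-lub (y ∷ ys) (y≤b ∷ ys≤b) = ⊔-lub y≤b (fold-lub ys ys≤b)

minL-lb : ∀ xs → All (minL xs ≤_) xs
minL-lb []       = []
minL-lb (x ∷ xs) = proj₁ (fold-lb x xs) ∷ proj₂ (fold-lb x xs)
  where
  fold-lb : ∀ x xs → foldr _⊓_ x xs ≤ x × All (foldr _⊓_ x xs ≤_) xs
  fold-lb x []       = ≤-refl , []
  fold-lb x (y ∷ ys) =
    let m≤x , m≤ys = fold-lb x ys
    in  ≤-trans (m⊓n≤n y _) m≤x , m⊓n≤m y _ ∷ All.map (≤-trans (m⊓n≤n y _)) m≤ys

minL-glb : ∀ {b} xs → 0 < length xs → All (b ≤_) xs → b ≤ minL xs
minL-glb (x ∷ xs) _ (b≤x ∷ b≤xs) = fold-glb xs b≤xs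
  where
  fold-glb : ∀ ys → All (_ ≤_) ys → _ ≤ foldr _⊓_ x ys
  fold-glb []       []           = b≤x
  fold-glb (y ∷ ys) (b≤y ∷ b≤ys) = ⊓-glb b≤y (fold-glb ys b≤ys)

length≤1+length-without : ∀ c {xs} → Unique xs →
                          length xs ≤ suc (length (filter (¬? ∘ (_≟ c)) xs))
length≤1+length-without c {[]}     _            = z≤n
length≤1+length-without c {x ∷ xs} (x∉xs ∷ xs!) with x ≟ c
... | yes refl
  rewrite filter-reject (¬? ∘ (_≟ x)) {xs = xs} (λ x≢x → x≢x refl)
        | filter-all (¬? ∘ (_≟ x)) (All.map ≢-sym x∉xs) = ≤-refl
... | no x≢c
  rewrite filter-accept (¬? ∘ (_≟ c)) {xs = xs} x≢c = s≤s (length≤1+length-without c xs!)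

unique⇒length≤width : ∀ lo d {xs} → Unique xs → All (_∈[ lo , lo + d ⟩) xs → length xs ≤ d
unique⇒length≤width lo zero    {[]}    _   _                    = z≤n
unique⇒length≤width lo zero    {x ∷ _} _   ((lo≤x , x<lo+0) ∷ _) =
  contradiction lo≤x (<⇒≱ (subst (x <_) (+-identityʳ lo) x<lo+0))
unique⇒length≤width lo (suc d) {xs}    xs! xs∈lo+1+d             =
  ≤-trans (length≤1+length-without (lo + d) xs!)
          (s≤s (unique⇒length≤width lo d (Unique.filter⁺ _ xs!)
                 (All.zipWith below-top (All.filter⁺ _ xs∈lo+1+d , All.all-filter _ xs))))
  where
  below-top : ∀ {x} → x ∈[ lo , lo + suc d ⟩ × ¬ x ≡ lo + d → x ∈[ lo , lo + d ⟩
  below-top {x} ((lo≤x , x<lo+1+d) , x≢lo+d) =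
    lo≤x , ≤∧≢⇒< (m<1+n⇒m≤n (subst (x <_) (+-suc lo d) x<lo+1+d)) x≢lo+d

length≤1+diam : ∀ {xs} → Unique xs → length xs ≤ suc (diam xs)
length≤1+diam {xs} xs! = unique⇒length≤width (minL xs) (suc (diam xs)) xs!
  (All.zipWith (λ (min≤x , x≤max) → min≤x , x<min+1+diam x≤max) (minL-lb xs , maxL-ub xs))
  where
  x<min+1+diam : ∀ {x} → x ≤ maxL xs → x < minL xs + suc (diam xs)
  x<min+1+diam {x} x≤max = subst (x <_) (sym (+-suc (minL xs) (diam xs)))
                             (s≤s (≤-trans x≤max (m≤n+m∸n (maxL xs) (minL xs))))

diam≤width : ∀ lo d {xs} → 0 < length xs → All (_∈[ lo , lo + suc d ⟩) xs → diam xs ≤ d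
diam≤width lo d {xs} nonempty xs∈lo+1+d = begin
  maxL xs ∸ minL xs
    ≤⟨ ∸-mono (maxL-lub xs (All.map x≤lo+d xs∈lo+1+d))
              (minL-glb xs nonempty (All.map proj₁ xs∈lo+1+d)) ⟩
  lo + d ∸ lo
    ≡⟨ m+n∸m≡n lo d ⟩
  d ∎
  where
  open ≤-Reasoning
  x≤lo+d : ∀ {x} → x ∈[ lo , lo + suc d ⟩ → x ≤ lo + d
  x≤lo+d {x} (_ , x<lo+1+d) = m<1+n⇒m≤n (subst (x <_) (+-suc lo d) x<lo+1+d)

colourClass : (ℕ → Fin 3) → Fin 3 → List ℕ → List ℕ
colourClass Δ k = filter (λ x → Δ x Fin.≟ k)

colourClasses-length : ∀ Δ xs →
  length (colourClass Δ 0F xs) + length (colourClass Δ 1F xs) + length (colourClass Δ 2F xs) ≡ length xs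
colourClasses-length Δ []       = refl
colourClasses-length Δ (x ∷ xs) with Δ x | colourClasses-length Δ xs
... | 0F | ih = cong suc ih
... | 1F | ih = trans (cong (_+ length (colourClass Δ 2F xs)) (+-suc (length (colourClass Δ 0F xs)) _))
                      (cong suc ih)
... | 2F | ih = trans (+-suc _ (length (colourClass Δ 2F xs))) (cong suc ih)

pigeonhole : ∀ Δ t xs → 3 * t < length xs → ∃ λ k → t < length (colourClass Δ k xs)
pigeonhole Δ t xs 3t<|xs| with t <? length (colourClass Δ 0F xs)
                             | t <? length (colourClass Δ 1F xs)
                             | t <? length (colourClass Δ 2F xs)
... | yes big | _       | _       = 0F , big
... | no _    | yes big | _       = 1F , big
... | no _    | no _    | yes big = 2F , big
... | no small₀ | no small₁ | no small₂ = contradiction 3t<|xs| (≤⇒≯ (begin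
  length xs
    ≡⟨ sym (colourClasses-length Δ xs) ⟩
  length (colourClass Δ 0F xs) + length (colourClass Δ 1F xs) + length (colourClass Δ 2F xs)
    ≤⟨ +-mono-≤ (+-mono-≤ (≮⇒≥ small₀) (≮⇒≥ small₁)) (≮⇒≥ small₂) ⟩
  t + t + t
    ≡⟨ trans (+-assoc t t t) (cong (λ u → t + (t + u)) (sym (+-identityʳ t))) ⟩
  3 * t ∎))
  where open ≤-Reasoning

monochromatic-subset : ∀ {P : ℕ → Set} Δ t {xs} → Unique xs → All P xs → 3 * t < length xs →
                       ∃ λ S → Unique S × All P S × Mono Δ S × length S ≡ suc t
monochromatic-subset Δ t {xs} xs! Pxs 3t<|xs| =
  take (suc t) class ,
  Unique.take⁺ _ (Unique.filter⁺ _ xs!) ,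
  All.take⁺ _ (All.filter⁺ _ Pxs) ,
  (k , All.take⁺ _ (All.all-filter _ xs)) ,
  trans (length-take (suc t) class) (m≤n⇒m⊓n≡m t<|class|)
  where
  k = proj₁ (pigeonhole Δ t xs 3t<|xs|)
  t<|class| = proj₂ (pigeonhole Δ t xs 3t<|xs|)
  class = colourClass Δ k xs

interval-monochromatic-subset : ∀ Δ t lo →
  ∃ λ S → Unique S × All (_∈[ lo , lo + suc (3 * t) ⟩) S × Mono Δ S × length S ≡ suc t
interval-monochromatic-subset Δ t lo =
  monochromatic-subset Δ t (interval-unique lo _) (interval-bounds lo _)
    (subst (3 * t <_) (sym (interval-length lo (suc (3 * t)))) (n<1+n (3 * t)))

Striped : (ℕ → Fin 3) → ℕ → ℕ → ℕ → Set
Striped Δ d lo hi = ∀ k → ∃ λ c → ∀ {x} → x ∈[ lo , hi ⟩ → Δ x ≡ k → x ∈[ c , c + d ⟩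

striped-cong : ∀ {Δ Δ′ d lo hi} → (∀ {x} → x ∈[ lo , hi ⟩ → Δ′ x ≡ Δ x) →
               Striped Δ d lo hi → Striped Δ′ d lo hi
striped-cong Δ′≗Δ striped k =
  let c , class⊆ = striped k
  in  c , λ x∈ Δ′x≡k → class⊆ x∈ (trans (sym (Δ′≗Δ x∈)) Δ′x≡k)

striped⇒mono-length≤ : ∀ {Δ d lo hi xs} → Striped Δ d lo hi →
                       Unique xs → All (_∈[ lo , hi ⟩) xs → Mono Δ xs → length xs ≤ d
striped⇒mono-length≤ {d = d} striped xs! xs∈ (k , Δxs≡k) =
  let c , class⊆ = striped k
  in  unique⇒length≤width c d xs! (All.zipWith (λ (x∈ , Δx≡k) → class⊆ x∈ Δx≡k) (xs∈ , Δxs≡k))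

stripes : ℕ → ℕ → ℕ → Fin 3
stripes lo d x with x <? lo + d
... | yes _ = 0F
... | no _ with x <? lo + d + d
...   | yes _ = 1F
...   | no _  = 2F

stripeStart : ℕ → ℕ → Fin 3 → ℕ
stripeStart lo d 0F = lo
stripeStart lo d 1F = lo + d
stripeStart lo d 2F = lo + d + d

stripes-∈-stripe : ∀ lo d {x} → x ∈[ lo , lo + 3 * d ⟩ →
                 let c = stripeStart lo d (stripes lo d x) in x ∈[ c , c + d ⟩
stripes-∈-stripe lo d {x} (lo≤x , x<lo+3d) with x <? lo + d
... | yes x<lo+d = lo≤x , x<lo+d
... | no x≮lo+d with x <? lo + d + d
...   | yes x<lo+2d = ≮⇒≥ x≮lo+d , x<lo+2d
...   | no x≮lo+2d  = ≮⇒≥ x≮lo+2d , subst (x <_) (lo+3d≡lo+d+d+d lo d) x<lo+3d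
  where
  lo+3d≡lo+d+d+d : ∀ lo d → lo + 3 * d ≡ lo + d + d + d
  lo+3d≡lo+d+d+d = solve-∀

stripes-striped : ∀ lo d → Striped (stripes lo d) d lo (lo + 3 * d)
stripes-striped lo d k = stripeStart lo d k , λ {x} x∈ Δx≡k →
  subst (λ j → x ∈[ stripeStart lo d j , stripeStart lo d j + d ⟩) Δx≡k (stripes-∈-stripe lo d x∈)

twoStripings : ℕ → ℕ → ℕ → Fin 3
twoStripings a b x with x <? 1 + 3 * a
... | yes _ = stripes 1 a x
... | no _  = stripes (2 + 3 * a) b x

twoStripings-striped₁ : ∀ a b → Striped (twoStripings a b) a 1 (1 + 3 * a)
twoStripings-striped₁ a b = striped-cong agree (stripes-striped 1 a)
  where
  agree : ∀ {x} → x ∈[ 1 , 1 + 3 * a ⟩ → twoStripings a b x ≡ stripes 1 a x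
  agree {x} (_ , x<1+3a) with x <? 1 + 3 * a
  ... | yes _     = refl
  ... | no x≮1+3a = contradiction x<1+3a x≮1+3a

twoStripings-striped₂ : ∀ a b → Striped (twoStripings a b) b (2 + 3 * a) (2 + 3 * a + 3 * b)
twoStripings-striped₂ a b = striped-cong agree (stripes-striped (2 + 3 * a) b)
  where
  agree : ∀ {x} → x ∈[ 2 + 3 * a , 2 + 3 * a + 3 * b ⟩ →
          twoStripings a b x ≡ stripes (2 + 3 * a) b x
  agree {x} (2+3a≤x , _) with x <? 1 + 3 * a
  ... | yes x<1+3a = contradiction (<-trans x<1+3a 2+3a≤x) (<-irrefl refl)
  ... | no _       = refl

lower-bound : ∀ a b n → n < 2 + 3 * a + 3 * b → ¬ Property (suc a) (suc b) n
lower-bound a b n n<N P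
  with P (twoStripings a b)
... | S₁ , S₂ , S₁! , S₂! , range₁ , range₂ , mono₁ , mono₂ , |S₁| , |S₂| , max₁<min₂ , _
  with maxL S₁ <? 1 + 3 * a
...   | yes max₁<1+3a = 1+n≰n (subst (_≤ a) |S₁|
          (striped⇒mono-length≤ (twoStripings-striped₁ a b) S₁! S₁∈ mono₁))
  where
  S₁∈ : All (_∈[ 1 , 1 + 3 * a ⟩) S₁
  S₁∈ = All.zipWith (λ ((1≤x , _) , x≤max) → 1≤x , ≤-<-trans x≤max max₁<1+3a) (range₁ , maxL-ub S₁)
...   | no max₁≮1+3a = 1+n≰n (subst (_≤ b) |S₂|
          (striped⇒mono-length≤ (twoStripings-striped₂ a b) S₂! S₂∈ mono₂))
  where
  S₂∈ : All (_∈[ 2 + 3 * a , 2 + 3 * a + 3 * b ⟩) S₂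
  S₂∈ = All.zipWith (λ ((_ , x≤n) , min≤x) → ≤-trans 2+3a≤min₂ min≤x , ≤-<-trans x≤n n<N)
                    (range₂ , minL-lb S₂)
    where
    2+3a≤min₂ : 2 + 3 * a ≤ minL S₂
    2+3a≤min₂ = ≤-trans (s≤s (≮⇒≥ max₁≮1+3a)) max₁<min₂

upper-bound : ∀ a b → 3 * a ≤ b → Property (suc a) (suc b) (2 + 3 * a + 3 * b)
upper-bound a b 3a≤b Δ
  with interval-monochromatic-subset Δ a 1 | interval-monochromatic-subset Δ b (2 + 3 * a)
... | S₁ , S₁! , S₁∈ , mono₁ , |S₁| | S₂ , S₂! , S₂∈ , mono₂ , |S₂| =
  S₁ , S₂ , S₁! , S₂! , All.map inRange₁ S₁∈ , All.map inRange₂ S₂∈ , mono₁ , mono₂ , |S₁| , |S₂| ,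
  max₁<min₂ , diam₁≤diam₂
  where
  N = 2 + 3 * a + 3 * b

  inRange₁ : ∀ {x} → x ∈[ 1 , 2 + 3 * a ⟩ → 1 ≤ x × x ≤ N
  inRange₁ (1≤x , x<2+3a) = 1≤x , ≤-trans (m<1+n⇒m≤n x<2+3a) (≤-trans (n≤1+n _) (m≤m+n _ (3 * b)))

  inRange₂ : ∀ {x} → x ∈[ 2 + 3 * a , 2 + 3 * a + suc (3 * b) ⟩ → 1 ≤ x × x ≤ N
  inRange₂ {x} (2+3a≤x , x<N+1) =
    ≤-trans (s≤s z≤n) 2+3a≤x , m<1+n⇒m≤n (subst (x <_) (+-suc (2 + 3 * a) (3 * b)) x<N+1)

  nonempty : ∀ S {t} → length S ≡ suc t → 0 < length S
  nonempty S |S|≡1+t = subst (0 <_) (sym |S|≡1+t) z<s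

  max₁<min₂ : maxL S₁ < minL S₂
  max₁<min₂ = ≤-trans (s≤s (maxL-lub S₁ (All.map (m<1+n⇒m≤n ∘ proj₂) S₁∈)))
                      (minL-glb S₂ (nonempty S₂ |S₂|) (All.map proj₁ S₂∈))

  diam₁≤diam₂ : diam S₁ ≤ diam S₂
  diam₁≤diam₂ = begin
    diam S₁ ≤⟨ diam≤width 1 (3 * a) (nonempty S₁ |S₁|) S₁∈ ⟩
    3 * a   ≤⟨ 3a≤b ⟩
    b       ≤⟨ s≤s⁻¹ (subst (_≤ suc (diam S₂)) |S₂| (length≤1+diam S₂!)) ⟩
    diam S₂ ∎
    where open ≤-Reasoning

3[1+a]+3[1+b]∸4≡2+3a+3b : ∀ a b → 3 * suc a + 3 * suc b ∸ 4 ≡ 2 + 3 * a + 3 * b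
3[1+a]+3[1+b]∸4≡2+3a+3b a b = cong (_∸ 4) (3[1+a]+3[1+b]≡4+2+3a+3b a b)
  where
  3[1+a]+3[1+b]≡4+2+3a+3b : ∀ a b → 3 * suc a + 3 * suc b ≡ 4 + (2 + 3 * a + 3 * b)
  3[1+a]+3[1+b]≡4+2+3a+3b = solve-∀

theorem4p6 : (s r : ℕ) → 2 ≤ s → s ≤ r → 3 * s ∸ 3 < r →
    IsF3 s r (3 * s + 3 * r ∸ 4)
theorem4p6 zero    _       ()  _ _
theorem4p6 (suc a) zero    _   _ ()
theorem4p6 (suc a) (suc b) _   _ 3s∸3<r
  rewrite 3[1+a]+3[1+b]∸4≡2+3a+3b a b =
  z<s , upper-bound a b 3a≤b , λ m _ m<N → lower-bound a b m m<N
  where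
  3a≤b : 3 * a ≤ b
  3a≤b = s≤s⁻¹ (subst (_< suc b) (cong (_∸ 3) (*-suc 3 a)) 3s∸3<r)
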